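{- For every nonnegative integer $n$ and every $0\le k\le n$, \[ B_{n,k}(q)=q^{2nk-n^2}\,B_{n,n-k}(q). \]
   Context: $\mathcal{B}_n$ is the group of signed permutations of $[n]$, written $\pi=\pi_1\cdots\pi_n$ with $\pi_0=0$, integers compared in the usual order. $\mathrm{Des}_B(\pi)=\{i\in\{0,\dots,n-1\}:\pi_i>\pi_{i+1}\}$, $\mathrm{des}_B(\pi)=|\mathrm{Des}_B(\pi)|$, $\mathrm{neg}(\pi)=|\{i\in[n]:\pi_i<0\}|$, $\mathrm{fmaj}(\pi)=\sum_{i\in\mathrm{Des}_B(\pi)}2i+\mathrm{neg}(\pi)$, and $B_{n,k}(q)=\sum_{\pi\in\mathcal{B}_n,\ \mathrm{des}_B(\pi)=k}q^{\mathrm{fmaj}(\pi)}$. -}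

module Defs where

open import Data.Nat as ℕ using (ℕ; zero; suc; _*_; _∸_)
open import Data.Bool using (Bool; true; false; _∧_; if_then_else_)
open import Data.Integer as ℤ using (ℤ; +_; -_)
open import Relation.Nullary.Decidable using (⌊_⌋)

_<ᵇ_ : ℤ → ℤ → Bool
infix 4 _<ᵇ_
a <ᵇ b = ⌊ a ℤ.<? b ⌋
open import Data.List using (List; []; _∷_; map; concatMap; length; filterᵇ; upTo)
open import Data.Nat.ListAction using (sum)

insertions : {A : Set} → A → List A → List (List A)
insertions x [] = (x ∷ []) ∷ []
insertions x (y ∷ ys) = (x ∷ y ∷ ys) ∷ map (y ∷_) (insertions x ys)

perms : {A : Set} → List A → List (List A)
perms [] = [] ∷ []
perms (x ∷ xs) = concatMap (insertions x) (perms xs)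

signings : List ℕ → List (List ℤ)
signings [] = [] ∷ []
signings (x ∷ xs) = concatMap (λ s → ((+ x) ∷ s) ∷ ((- (+ x)) ∷ s) ∷ []) (signings xs)

[_] : ℕ → List ℕ
[ n ] = map suc (upTo n)

-- The hyperoctahedral group B_n, as the list of all words π₁⋯πₙ
-- (each signed permutation occurs exactly once).
signedPerms : ℕ → List (List ℤ)
signedPerms n = concatMap signings (perms [ n ])

descPos : ℕ → List ℤ → List ℕ
descPos i [] = []
descPos i (a ∷ []) = []
descPos i (a ∷ b ∷ rest) =
  if b <ᵇ a then i ∷ descPos (suc i) (b ∷ rest) else descPos (suc i) (b ∷ rest)

-- Des_B(π) computed on 0 π₁ ⋯ πₙ (π₀ = 0)
DesB : List ℤ → List ℕ
DesB π = descPos 0 (+ 0 ∷ π)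

desB : List ℤ → ℕ
desB π = length (DesB π)

neg : List ℤ → ℕ
neg π = length (filterᵇ (λ a → a <ᵇ (+ 0)) π)

fmaj : List ℤ → ℕ
fmaj π = sum (map (λ i → 2 * i) (DesB π)) ℕ.+ neg π

-- Coefficient of q^m in B_{n,k}(q), for m ∈ ℤ (zero for m < 0):
-- number of π ∈ B_n with des_B π = k and fmaj π = m.
Bcoeff : ℕ → ℕ → ℤ → ℕ
Bcoeff n k m =
  length (filterᵇ (λ π → (desB π ℕ.≡ᵇ k) ∧ ⌊ (+ fmaj π) ℤ.≟ m ⌋) (signedPerms n))

-- Let h exchange the blocks [-n, 0] and [1, n+1] of the integers by a translation of n+1, and
-- let ψ(π) = h(πₙ) ⋯ h(π₁). Then ψ is an involution of B_n, and reading the word 0 π₁ ⋯ πₙ (n+1)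
-- backwards through h gives 0 ψ(π) (n+1). For consecutive letters a, b of that word
--   [h a < h b] + [b < a] = 1 + [0 < a] - [0 < b],
-- where [h a < h b] is a descent of ψ(π) read at the mirrored position. Summing this identity
-- along the word, plainly and weighted by position, telescopes to
--   des_B ψ(π) + des_B π = n   and   fmaj ψ(π) + 2n des_B π = fmaj π + n²,
-- so ψ maps the π with des_B π = k and fmaj π = m onto those with des_B = n - k and
-- fmaj = m - (2nk - n²).

module Submission where

open import Defs
open import Data.Bool using (Bool; true; false; T; _∧_; if_then_else_)
open import Data.Empty using (⊥; ⊥-elim)
open import Data.Nat as ℕ using (ℕ; zero; suc; _+_; _*_; _∸_; _≤_; _<_; z≤n; s≤s; _≡ᵇ_)
import Data.Nat.Properties as ℕ
open import Data.Nat.ListAction using (sum)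
open import Data.Nat.ListAction.Properties using (sum-++; sum-↭)
open import Data.Nat.Tactic.RingSolver using (solve-∀)
open import Data.Integer as ℤ using (ℤ; +_; -[1+_]; _-_; -_; ∣_∣; +<+; +≤+)
import Data.Integer.Properties as ℤ
import Data.Integer.Tactic.RingSolver as ℤ-Solver
open import Data.List
  using (List; []; _∷_; _++_; _∷ʳ_; map; concatMap; length; filterᵇ; upTo; drop; reverse)
open import Data.List.Properties
  using (∷-injectiveˡ; ∷-injectiveʳ; unfold-reverse; length-reverse; reverse-involutive;
         length-map; length-upTo; length-++; map-++; map-∘; map-id; map-cong-local; reverse-map)
open import Data.List.Membership.Propositional using (_∈_; _∉_; lose; find)
open import Data.List.Membership.Propositional.Properties
  using (∈-concatMap⁺; ∈-concatMap⁻; ∈-map⁺; ∈-map⁻; ∈-∃++; ∈-upTo⁺; ∈-upTo⁻)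
open import Data.List.Membership.Propositional.Properties.WithK using (unique∧set⇒bag)
open import Data.List.Relation.Binary.BagAndSetEquality using (∼bag⇒↭)
open import Data.List.Relation.Binary.Permutation.Propositional
  using (_↭_; ↭-refl; ↭-sym; ↭-trans; ↭-prep; ↭-swap; ↭⇒↭ₛ)
import Data.List.Relation.Binary.Permutation.Setoid.Properties as ↭ₛ
import Data.List.Relation.Binary.Permutation.Propositional.Properties as ↭
open import Data.List.Relation.Unary.Any using (here; there)
open import Data.List.Relation.Unary.All as All using (All; []; _∷_)
open import Data.List.Relation.Unary.AllPairs using ([]; _∷_)
open import Data.List.Relation.Unary.Linked as Linked using (Linked)
open import Data.List.Relation.Unary.Linked.Properties using (AllPairs⇒Linked)
import Data.List.Relation.Unary.All.Properties as All
open import Data.List.Relation.Unary.Unique.Propositional using (Unique)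
import Data.List.Relation.Unary.Unique.Propositional.Properties as Unique
open import Data.Product using (∃; _×_; _,_; proj₁; proj₂)
open import Data.Sum using (inj₁; inj₂)
open import Function using (_∘_; flip; mk⇔)
open import Relation.Binary.Definitions using (DecidableEquality; tri<; tri≈; tri>)
open import Relation.Binary.PropositionalEquality
  using (_≡_; _≢_; refl; sym; trans; cong; cong₂; subst; subst₂; setoid; module ≡-Reasoning)
open import Relation.Nullary using (¬_; Dec; yes; no; contradiction)
open import Relation.Nullary.Decidable using (T?; ⌊_⌋; dec-true; dec-false; isYes≗does; toSum)

open ≡-Reasoning

private variable
  A B C : Set

∈-concatMap-intro : (f : A → List B) {xs : List A} {x : A} {y : B} →
                    x ∈ xs → y ∈ f x → y ∈ concatMap f xs
∈-concatMap-intro f x∈xs y∈fx = ∈-concatMap⁺ f (lose x∈xs y∈fx)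

∈-concatMap-elim : (f : A → List B) {xs : List A} {y : B} →
                   y ∈ concatMap f xs → ∃ λ x → x ∈ xs × y ∈ f x
∈-concatMap-elim f = find ∘ ∈-concatMap⁻ f

Unique-concatMap⁺ : (f : A → List B) (g : B → A) {xs : List A} → Unique xs →
                    (∀ {x} → x ∈ xs → Unique (f x)) →
                    (∀ {x y} → x ∈ xs → y ∈ f x → g y ≡ x) →
                    Unique (concatMap f xs)
Unique-concatMap⁺ f g {[]} [] _ _ = []
Unique-concatMap⁺ f g {x ∷ xs} (x∉xs ∷ !xs) !f g-inv =
  Unique.++⁺ (!f (here refl)) (Unique-concatMap⁺ f g !xs (!f ∘ there) (g-inv ∘ there)) disjoint
  where
  disjoint : ∀ {y} → y ∈ f x × y ∈ concatMap f xs → ⊥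
  disjoint (y∈fx , y∈rest) with x′ , x′∈xs , y∈fx′ ← ∈-concatMap-elim f y∈rest =
    All.lookup x∉xs x′∈xs (trans (sym (g-inv (here refl) y∈fx)) (g-inv (there x′∈xs) y∈fx′))

Unique-map⁺-local : (f : A → B) {xs : List A} → Unique xs →
                    (∀ {x y} → x ∈ xs → y ∈ xs → f x ≡ f y → x ≡ y) → Unique (map f xs)
Unique-map⁺-local f {[]}     []           _   = []
Unique-map⁺-local f {x ∷ xs} (x∉xs ∷ !xs) inj =
  All.tabulate distinct ∷ Unique-map⁺-local f !xs λ p q → inj (there p) (there q)
  where
  distinct : ∀ {z} → z ∈ map f xs → f x ≢ z
  distinct z∈ fx≡z with y , y∈xs , refl ← ∈-map⁻ f z∈ =
    All.lookup x∉xs y∈xs (inj (here refl) (there y∈xs) fx≡z)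

Unique-resp-↭ : {xs ys : List A} → xs ↭ ys → Unique xs → Unique ys
Unique-resp-↭ {A} p = ↭ₛ.Unique-resp-↭ (setoid A) (↭⇒↭ₛ p)

map-involution-↭ : (f : A → A) {xs : List A} → Unique xs →
                   (∀ {x} → x ∈ xs → f x ∈ xs) → (∀ {x} → x ∈ xs → f (f x) ≡ x) →
                   map f xs ↭ xs
map-involution-↭ f {xs} !xs closed involutive =
  ∼bag⇒↭ (unique∧set⇒bag (Unique-map⁺-local f !xs injective) !xs (mk⇔ to from))
  where
  injective : ∀ {x y} → x ∈ xs → y ∈ xs → f x ≡ f y → x ≡ y
  injective {x} {y} x∈ y∈ fx≡fy = trans (sym (involutive x∈)) (trans (cong f fx≡fy) (involutive y∈))
  to : ∀ {y} → y ∈ map f xs → y ∈ xs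
  to y∈ with x , x∈ , refl ← ∈-map⁻ f y∈ = closed x∈
  from : ∀ {y} → y ∈ xs → y ∈ map f xs
  from y∈ = subst (_∈ map f xs) (involutive y∈) (∈-map⁺ f (closed y∈))

length-filterᵇ-map : (p : B → Bool) (q : A → Bool) (f : A → B) {xs : List A} →
                     (∀ {x} → x ∈ xs → p (f x) ≡ q x) →
                     length (filterᵇ p (map f xs)) ≡ length (filterᵇ q xs)
length-filterᵇ-map p q f {[]} _ = refl
length-filterᵇ-map p q f {x ∷ xs} pf≡q with p (f x) | q x | pf≡q (here refl)
... | true  | true  | _ = cong suc (length-filterᵇ-map p q f (pf≡q ∘ there))
... | false | false | _ = length-filterᵇ-map p q f (pf≡q ∘ there)

length-filterᵇ-involution : (p q : A → Bool) (f : A → A) {xs : List A} → Unique xs →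
                            (∀ {x} → x ∈ xs → f x ∈ xs) →
                            (∀ {x} → x ∈ xs → f (f x) ≡ x) →
                            (∀ {x} → x ∈ xs → p (f x) ≡ q x) →
                            length (filterᵇ p xs) ≡ length (filterᵇ q xs)
length-filterᵇ-involution p q f !xs closed involutive pf≡q =
  trans (sym (↭.↭-length (↭.filter-↭ (T? ∘ p) (map-involution-↭ f !xs closed involutive))))
        (length-filterᵇ-map p q f pf≡q)

Linked-fromAll : {P : A → Set} {R S : A → A → Set} → (∀ {a b} → P a → P b → R a b → S a b) →
                 ∀ {xs} → All P xs → Linked R xs → Linked S xs
Linked-fromAll h _                Linked.[]        = Linked.[]
Linked-fromAll h _                Linked.[-]       = Linked.[-]
Linked-fromAll h (pa ∷ pb ∷ ps) (r Linked.∷ rs) = h pa pb r Linked.∷ Linked-fromAll h (pb ∷ ps) rs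

indicator : Bool → ℕ
indicator true  = 1
indicator false = 0

length-filterᵇ : (p : A → Bool) (xs : List A) → length (filterᵇ p xs) ≡ sum (map (indicator ∘ p) xs)
length-filterᵇ p []       = refl
length-filterᵇ p (x ∷ xs) with p x
... | true  = cong suc (length-filterᵇ p xs)
... | false = length-filterᵇ p xs

sum-map-*ˡ : ∀ c xs → sum (map (λ i → c * i) xs) ≡ c * sum xs
sum-map-*ˡ c []       = sym (ℕ.*-zeroʳ c)
sum-map-*ˡ c (x ∷ xs) =
  trans (cong (λ s → c * x + s) (sum-map-*ˡ c xs)) (sym (ℕ.*-distribˡ-+ c x (sum xs)))

sum-complementary : (f g : A → ℕ) {xs : List A} → All (λ x → f x + g x ≡ 1) xs →
                    sum (map f xs) + sum (map g xs) ≡ length xs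
sum-complementary f g {[]}     []           = refl
sum-complementary f g {x ∷ xs} (fx+gx ∷ hs) = begin
  f x + sf + (g x + sg)   ≡⟨ regroup (f x) (g x) sf sg ⟩
  (f x + g x) + (sf + sg) ≡⟨ cong₂ _+_ fx+gx (sum-complementary f g hs) ⟩
  suc (length xs)         ∎
  where
  sf sg : ℕ
  sf = sum (map f xs)
  sg = sum (map g xs)
  regroup : ∀ a b s t → a + s + (b + t) ≡ (a + b) + (s + t)
  regroup = solve-∀

⌊⌋-yes : {P : Set} (p? : Dec P) → P → ⌊ p? ⌋ ≡ true
⌊⌋-yes p? p = trans (isYes≗does p?) (dec-true p? p)

⌊⌋-no : {P : Set} (p? : Dec P) → ¬ P → ⌊ p? ⌋ ≡ false
⌊⌋-no p? ¬p = trans (isYes≗does p?) (dec-false p? ¬p)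

<ᵇ-true : ∀ {x y} → x ℤ.< y → (x <ᵇ y) ≡ true
<ᵇ-true {x} {y} = ⌊⌋-yes (x ℤ.<? y)

<ᵇ-false : ∀ {x y} → ¬ x ℤ.< y → (x <ᵇ y) ≡ false
<ᵇ-false {x} {y} = ⌊⌋-no (x ℤ.<? y)

-- Signed permutations

∈-insertions⁻ : (x : A) (xs : List A) {ys : List A} → ys ∈ insertions x xs → ys ↭ x ∷ xs
∈-insertions⁻ x []       (here refl) = ↭-refl
∈-insertions⁻ x (y ∷ xs) (here refl) = ↭-refl
∈-insertions⁻ x (y ∷ xs) (there p) with zs , zs∈ , refl ← ∈-map⁻ (y ∷_) p =
  ↭-trans (↭-prep y (∈-insertions⁻ x xs zs∈)) (↭-swap y x ↭-refl)

∈-insertions⁺ : (x : A) (ys zs : List A) → ys ++ x ∷ zs ∈ insertions x (ys ++ zs)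
∈-insertions⁺ x []       []       = here refl
∈-insertions⁺ x []       (z ∷ zs) = here refl
∈-insertions⁺ x (y ∷ ys) zs       = there (∈-map⁺ (y ∷_) (∈-insertions⁺ x ys zs))

∈-perms⁻ : (xs : List A) {ys : List A} → ys ∈ perms xs → ys ↭ xs
∈-perms⁻ []       (here refl) = ↭-refl
∈-perms⁻ (x ∷ xs) p with zs , zs∈ , ys∈ ← ∈-concatMap-elim (insertions x) p =
  ↭-trans (∈-insertions⁻ x zs ys∈) (↭-prep x (∈-perms⁻ xs zs∈))

∈-perms⁺ : (xs : List A) {ys : List A} → ys ↭ xs → ys ∈ perms xs
∈-perms⁺ [] ys↭[] with refl ← ↭.↭-empty-inv ys↭[] = here refl
∈-perms⁺ (x ∷ xs) ys↭ with us , vs , refl ← ∈-∃++ (↭.∈-resp-↭ (↭-sym ys↭) (here refl)) =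
  ∈-concatMap-intro (insertions x) (∈-perms⁺ xs (↭.drop-mid us [] ys↭)) (∈-insertions⁺ x us vs)

module _ (_≟_ : DecidableEquality A) where

  delete : A → List A → List A
  delete x [] = []
  delete x (y ∷ ys) with x ≟ y
  ... | yes _ = ys
  ... | no  _ = y ∷ delete x ys

  delete-head : (x : A) (xs : List A) → delete x (x ∷ xs) ≡ xs
  delete-head x xs with x ≟ x
  ... | yes _   = refl
  ... | no  x≢x = contradiction refl x≢x

  delete-insertions : (x : A) (xs : List A) → x ∉ xs →
                      ∀ {ys} → ys ∈ insertions x xs → delete x ys ≡ xs
  delete-insertions x []       _ (here refl) = delete-head x []
  delete-insertions x (y ∷ xs) _ (here refl) = delete-head x (y ∷ xs)
  delete-insertions x (y ∷ xs) x∉ (there p) with zs , zs∈ , refl ← ∈-map⁻ (y ∷_) p | x ≟ y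
  ... | yes refl = contradiction (here refl) x∉
  ... | no  _    = cong (y ∷_) (delete-insertions x xs (x∉ ∘ there) zs∈)

  Unique-insertions : (x : A) (xs : List A) → x ∉ xs → Unique (insertions x xs)
  Unique-insertions x []       _  = [] ∷ []
  Unique-insertions x (y ∷ xs) x∉ =
    All.tabulate head-differs ∷ Unique.map⁺ ∷-injectiveʳ (Unique-insertions x xs (x∉ ∘ there))
    where
    head-differs : ∀ {zs} → zs ∈ map (y ∷_) (insertions x xs) → x ∷ y ∷ xs ≢ zs
    head-differs zs∈ x∷y∷xs≡zs with _ , _ , refl ← ∈-map⁻ (y ∷_) zs∈ =
      x∉ (here (∷-injectiveˡ x∷y∷xs≡zs))

  Unique-perms : {xs : List A} → Unique xs → Unique (perms xs)
  Unique-perms {[]}     _ = [] ∷ []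
  Unique-perms {x ∷ xs} (x∉xs ∷ !xs) =
    Unique-concatMap⁺ (insertions x) (delete x) (Unique-perms !xs)
      (λ zs∈ → Unique-insertions x _ (x∉ zs∈))
      (λ zs∈ → delete-insertions x _ (x∉ zs∈))
    where
    x∉ : ∀ {zs} → zs ∈ perms xs → x ∉ zs
    x∉ zs∈ x∈zs = All.lookup x∉xs (↭.∈-resp-↭ (∈-perms⁻ xs zs∈) x∈zs) refl

prependSigned : ℕ → List ℤ → List (List ℤ)
prependSigned x s = ((+ x) ∷ s) ∷ ((ℤ.- (+ x)) ∷ s) ∷ []

∈-signings⁻ : (xs : List ℕ) {ws : List ℤ} → ws ∈ signings xs → map ∣_∣ ws ≡ xs
∈-signings⁻ []       (here refl) = refl
∈-signings⁻ (x ∷ xs) p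
  with vs , vs∈ , ws∈ ← ∈-concatMap-elim (prependSigned x) {signings xs} p | ws∈
... | here refl         = cong (x ∷_) (∈-signings⁻ xs vs∈)
... | there (here refl) = cong₂ _∷_ (ℤ.∣-i∣≡∣i∣ (+ x)) (∈-signings⁻ xs vs∈)

∈-signings⁺ : (ws : List ℤ) → ws ∈ signings (map ∣_∣ ws)
∈-signings⁺ []              = here refl
∈-signings⁺ (+ k ∷ ws)      = ∈-concatMap-intro (prependSigned k) (∈-signings⁺ ws) (here refl)
∈-signings⁺ (-[1+ k ] ∷ ws) =
  ∈-concatMap-intro (prependSigned (suc k)) (∈-signings⁺ ws) (there (here refl))

Unique-signings : {xs : List ℕ} → All (0 <_) xs → Unique (signings xs)
Unique-signings {[]}         _          = [] ∷ []
Unique-signings {suc x ∷ xs} (_ ∷ 0<xs) =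
  Unique-concatMap⁺ (prependSigned (suc x)) (drop 1) (Unique-signings 0<xs)
    (λ _ → ((λ ()) ∷ []) ∷ [] ∷ [])
    (λ { _ (here refl) → refl ; _ (there (here refl)) → refl })

∈-[_]⁻ : ∀ n {k} → k ∈ [ n ] → 0 < k × k ≤ n
∈-[ n ]⁻ k∈ with i , i∈ , refl ← ∈-map⁻ suc k∈ = s≤s z≤n , ∈-upTo⁻ i∈

∈-[_]⁺ : ∀ n {k} → 0 < k → k ≤ n → k ∈ [ n ]
∈-[ n ]⁺ {suc k} _ k<n = ∈-map⁺ suc (∈-upTo⁺ k<n)

Unique-[_] : ∀ n → Unique [ n ]
Unique-[ n ] = Unique.map⁺ ℕ.suc-injective (Unique.upTo⁺ n)

∈-signedPerms⁻ : ∀ n {w} → w ∈ signedPerms n → map ∣_∣ w ↭ [ n ]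
∈-signedPerms⁻ n p with xs , xs∈ , w∈ ← ∈-concatMap-elim signings p =
  subst (_↭ [ n ]) (sym (∈-signings⁻ xs w∈)) (∈-perms⁻ [ n ] xs∈)

∈-signedPerms⁺ : ∀ n {w} → map ∣_∣ w ↭ [ n ] → w ∈ signedPerms n
∈-signedPerms⁺ n {w} ∣w∣↭[n] =
  ∈-concatMap-intro signings (∈-perms⁺ [ n ] ∣w∣↭[n]) (∈-signings⁺ w)

Unique-signedPerms : ∀ n → Unique (signedPerms n)
Unique-signedPerms n =
  Unique-concatMap⁺ signings (map ∣_∣) (Unique-perms ℕ._≟_ Unique-[ n ])
    (λ xs∈ → Unique-signings (↭.All-resp-↭ (↭-sym (∈-perms⁻ [ n ] xs∈)) 0<[n]))
    (λ {xs} _ → ∈-signings⁻ xs)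
  where
  0<[n] : All (0 <_) [ n ]
  0<[n] = All.tabulate (proj₁ ∘ ∈-[ n ]⁻)

-- Descents along a word

steps : (A → A → B) → A → List A → List B
steps f x []       = []
steps f x (y ∷ ys) = f x y ∷ steps f y ys

lastOf : A → List A → A
lastOf x []       = x
lastOf x (y ∷ ys) = lastOf y ys

All-lastOf : {P : A → Set} (x : A) (xs : List A) → All P (x ∷ xs) → P (lastOf x xs)
All-lastOf x []       (px ∷ _)  = px
All-lastOf x (y ∷ ys) (_ ∷ pys) = All-lastOf y ys pys

length-steps : (f : A → A → B) (x : A) (xs : List A) → length (steps f x xs) ≡ length xs
length-steps f x []       = refl
length-steps f x (y ∷ ys) = cong suc (length-steps f y ys)

steps-map : (f : B → B → C) (g : A → B) (x : A) (xs : List A) →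
            steps f (g x) (map g xs) ≡ steps (λ a b → f (g a) (g b)) x xs
steps-map f g x []       = refl
steps-map f g x (y ∷ ys) = cong (_ ∷_) (steps-map f g y ys)

lastOf-∷ʳ : (x : A) (xs : List A) (y : A) → lastOf x (xs ∷ʳ y) ≡ y
lastOf-∷ʳ x []       y = refl
lastOf-∷ʳ x (z ∷ zs) y = lastOf-∷ʳ z zs y

steps-∷ʳ : (f : A → A → B) (x : A) (xs : List A) (y : A) →
           steps f x (xs ∷ʳ y) ≡ steps f x xs ∷ʳ f (lastOf x xs) y
steps-∷ʳ f x []       y = refl
steps-∷ʳ f x (z ∷ zs) y = cong (f x z ∷_) (steps-∷ʳ f z zs y)

steps-reverse : (f : A → A → B) (x : A) (xs : List A) (y : A) →
                steps f y (reverse xs ∷ʳ x) ≡ reverse (steps (flip f) x (xs ∷ʳ y))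
steps-reverse f x []       y = refl
steps-reverse f x (z ∷ zs) y = begin
  steps f y (reverse (z ∷ zs) ∷ʳ x)
    ≡⟨ cong (λ ws → steps f y (ws ∷ʳ x)) (unfold-reverse z zs) ⟩
  steps f y ((reverse zs ∷ʳ z) ∷ʳ x)
    ≡⟨ steps-∷ʳ f y (reverse zs ∷ʳ z) x ⟩
  steps f y (reverse zs ∷ʳ z) ∷ʳ f (lastOf y (reverse zs ∷ʳ z)) x
    ≡⟨ cong₂ (λ ws w → ws ∷ʳ f w x) (steps-reverse f z zs y) (lastOf-∷ʳ y (reverse zs) z) ⟩
  reverse (steps (flip f) z (zs ∷ʳ y)) ∷ʳ f z x
    ≡⟨ unfold-reverse (f z x) (steps (flip f) z (zs ∷ʳ y)) ⟨
  reverse (steps (flip f) x ((z ∷ zs) ∷ʳ y)) ∎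

weightFrom : ℕ → List ℕ → ℕ
weightFrom i []       = 0
weightFrom i (x ∷ xs) = i * x + weightFrom (suc i) xs

weight : List ℕ → ℕ
weight = weightFrom 0

weightFrom-suc : ∀ i xs → weightFrom (suc i) xs ≡ sum xs + weightFrom i xs
weightFrom-suc i []       = refl
weightFrom-suc i (x ∷ xs) = begin
  suc i * x + weightFrom (suc (suc i)) xs
    ≡⟨ cong (λ w → suc i * x + w) (weightFrom-suc (suc i) xs) ⟩
  suc i * x + (sum xs + weightFrom (suc i) xs)
    ≡⟨ regroup i x (sum xs) (weightFrom (suc i) xs) ⟩
  x + sum xs + (i * x + weightFrom (suc i) xs) ∎
  where
  regroup : ∀ i x s w → suc i * x + (s + w) ≡ x + s + (i * x + w)
  regroup = solve-∀

weightFrom-∷ʳ : ∀ i xs y → weightFrom i (xs ∷ʳ y) ≡ weightFrom i xs + (i + length xs) * y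
weightFrom-∷ʳ i []       y = trans (ℕ.+-identityʳ (i * y)) (cong (_* y) (sym (ℕ.+-identityʳ i)))
weightFrom-∷ʳ i (x ∷ xs) y = begin
  i * x + weightFrom (suc i) (xs ∷ʳ y)
    ≡⟨ cong (λ w → i * x + w) (weightFrom-∷ʳ (suc i) xs y) ⟩
  i * x + (weightFrom (suc i) xs + (suc i + length xs) * y)
    ≡⟨ regroup i x (weightFrom (suc i) xs) (length xs) y ⟩
  i * x + weightFrom (suc i) xs + (i + suc (length xs)) * y ∎
  where
  regroup : ∀ i x w l y → i * x + (w + (suc i + l) * y) ≡ i * x + w + (i + suc l) * y
  regroup = solve-∀

weight-reverse : ∀ xs → weight (reverse xs) + weight xs + sum xs ≡ length xs * sum xs
weight-reverse []       = refl
weight-reverse (x ∷ xs) = begin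
  weight (reverse (x ∷ xs)) + weightFrom 1 xs + (x + sum xs)
    ≡⟨ cong₂ (λ u v → u + v + (x + sum xs)) weight-rev-∷ (weightFrom-suc 0 xs) ⟩
  weight (reverse xs) + length xs * x + (sum xs + weight xs) + (x + sum xs)
    ≡⟨ regroup (weight (reverse xs)) (weight xs) (sum xs) (length xs) x ⟩
  (weight (reverse xs) + weight xs + sum xs) + (length xs * x + x + sum xs)
    ≡⟨ cong (_+ (length xs * x + x + sum xs)) (weight-reverse xs) ⟩
  length xs * sum xs + (length xs * x + x + sum xs)
    ≡⟨ collect (length xs) x (sum xs) ⟩
  suc (length xs) * (x + sum xs) ∎
  where
  weight-rev-∷ : weight (reverse (x ∷ xs)) ≡ weight (reverse xs) + length xs * x
  weight-rev-∷ = begin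
    weight (reverse (x ∷ xs))
      ≡⟨ cong weight (unfold-reverse x xs) ⟩
    weight (reverse xs ∷ʳ x)
      ≡⟨ weightFrom-∷ʳ 0 (reverse xs) x ⟩
    weight (reverse xs) + length (reverse xs) * x
      ≡⟨ cong (λ l → weight (reverse xs) + l * x) (length-reverse xs) ⟩
    weight (reverse xs) + length xs * x ∎
  regroup : ∀ r w s l x → r + l * x + (s + w) + (x + s) ≡ (r + w + s) + (l * x + x + s)
  regroup = solve-∀
  collect : ∀ l x s → l * s + (l * x + x + s) ≡ suc l * (x + s)
  collect = solve-∀

Telescoping : (f g : A → A → ℕ) (p : A → ℕ) → A → A → Set
Telescoping f g p a b = f a b + g a b + p b ≡ 1 + p a

module _ (f g : A → A → ℕ) (p : A → ℕ) where

  sum-steps-telescope : ∀ x xs → Linked (Telescoping f g p) (x ∷ xs) →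
    sum (steps f x xs) + sum (steps g x xs) + p (lastOf x xs) ≡ length xs + p x
  sum-steps-telescope x []       _ = refl
  sum-steps-telescope x (y ∷ ys) (law Linked.∷ laws) = begin
    f x y + sum (steps f y ys) + (g x y + sum (steps g y ys)) + p (lastOf y ys)
      ≡⟨ regroup (f x y) (g x y) (sum (steps f y ys)) (sum (steps g y ys)) (p (lastOf y ys)) ⟩
    (sum (steps f y ys) + sum (steps g y ys) + p (lastOf y ys)) + (f x y + g x y)
      ≡⟨ cong (_+ (f x y + g x y)) (sum-steps-telescope y ys laws) ⟩
    length ys + p y + (f x y + g x y)
      ≡⟨ regroup′ (length ys) (p y) (f x y) (g x y) ⟩
    length ys + (f x y + g x y + p y)
      ≡⟨ cong (λ k → length ys + k) law ⟩
    length ys + suc (p x)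
      ≡⟨ ℕ.+-suc (length ys) (p x) ⟩
    suc (length ys) + p x ∎
    where
    regroup : ∀ a b s t q → a + s + (b + t) + q ≡ (s + t + q) + (a + b)
    regroup = solve-∀
    regroup′ : ∀ m q a b → m + q + (a + b) ≡ m + (a + b + q)
    regroup′ = solve-∀

  weight-steps-telescope : ∀ x xs → Linked (Telescoping f g p) (x ∷ xs) →
    2 * (weight (steps f x xs) + weight (steps g x xs)) + 2 * length xs * p (lastOf x xs) + length xs
      ≡ length xs * length xs + 2 * sum (map p xs)
  weight-steps-telescope x []       _ = refl
  weight-steps-telescope x (y ∷ ys) (_ Linked.∷ laws) = begin
    2 * (weightFrom 1 F + weightFrom 1 G) + 2 * suc m * q + suc m
      ≡⟨ cong₂ (λ u v → 2 * (u + v) + 2 * suc m * q + suc m)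
               (weightFrom-suc 0 F) (weightFrom-suc 0 G) ⟩
    2 * (sum F + weight F + (sum G + weight G)) + 2 * suc m * q + suc m
      ≡⟨ regroup (sum F) (sum G) (weight F) (weight G) m q ⟩
    (2 * (weight F + weight G) + 2 * m * q + m) + 2 * (sum F + sum G + q) + 1
      ≡⟨ cong₂ (λ u v → u + 2 * v + 1)
               (weight-steps-telescope y ys laws) (sum-steps-telescope y ys laws) ⟩
    (m * m + 2 * sum (map p ys)) + 2 * (m + p y) + 1
      ≡⟨ collect m (sum (map p ys)) (p y) ⟩
    suc m * suc m + 2 * (p y + sum (map p ys)) ∎
    where
    F G : List ℕ
    F = steps f y ys
    G = steps g y ys
    m q : ℕ
    m = length ys
    q = p (lastOf y ys)
    regroup : ∀ sf sg wf wg m q →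
      2 * (sf + wf + (sg + wg)) + 2 * suc m * q + suc m
      ≡ (2 * (wf + wg) + 2 * m * q + m) + 2 * (sf + sg + q) + 1
    regroup = solve-∀
    collect : ∀ m s r → (m * m + 2 * s) + 2 * (m + r) + 1 ≡ suc m * suc m + 2 * (r + s)
    collect = solve-∀

descent : ℤ → ℤ → ℕ
descent a b = indicator (b <ᵇ a)

positive : ℤ → ℕ
positive x = indicator (+ 0 <ᵇ x)

negative : ℤ → ℕ
negative x = indicator (x <ᵇ + 0)

length-descPos : ∀ i x xs → length (descPos i (x ∷ xs)) ≡ sum (steps descent x xs)
length-descPos i x []       = refl
length-descPos i x (y ∷ ys) with y <ᵇ x
... | true  = cong suc (length-descPos (suc i) y ys)
... | false = length-descPos (suc i) y ys

sum-descPos : ∀ i x xs → sum (descPos i (x ∷ xs)) ≡ weightFrom i (steps descent x xs)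
sum-descPos i x []       = refl
sum-descPos i x (y ∷ ys) with y <ᵇ x
... | true  = cong₂ _+_ (sym (ℕ.*-identityʳ i)) (sum-descPos (suc i) y ys)
... | false = trans (sum-descPos (suc i) y ys)
                    (cong (_+ weightFrom (suc i) (steps descent y ys)) (sym (ℕ.*-zeroʳ i)))

sum-∷ʳ-0 : ∀ xs → sum (xs ∷ʳ 0) ≡ sum xs
sum-∷ʳ-0 xs = trans (sum-++ xs (0 ∷ [])) (ℕ.+-identityʳ (sum xs))

weight-∷ʳ-0 : ∀ xs → weight (xs ∷ʳ 0) ≡ weight xs
weight-∷ʳ-0 xs = trans (weightFrom-∷ʳ 0 xs 0)
  (trans (cong (λ c → weight xs + c) (ℕ.*-zeroʳ (length xs))) (ℕ.+-identityʳ (weight xs)))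

-- The descent indicators of 0 π₁ ⋯ πₙ (n+1). The sentinel n+1 adds no descent, and it makes the
-- extended word of π the mirror image, through halfTurn, of the extended word of turnAround n π.
descents : ℕ → List ℤ → List ℕ
descents n w = steps descent (+ 0) (w ∷ʳ + suc n)

module _ {n : ℕ} {w : List ℤ} (w≤n : All (ℤ._≤ + n) w) where

  descents-∷ʳ : descents n w ≡ steps descent (+ 0) w ∷ʳ 0
  descents-∷ʳ = trans (steps-∷ʳ descent (+ 0) w (+ suc n))
    (cong (λ b → steps descent (+ 0) w ∷ʳ indicator b) (<ᵇ-false (ℤ.≤⇒≯ last≤N)))
    where
    last≤N : lastOf (+ 0) w ℤ.≤ + suc n
    last≤N = ℤ.≤-trans (All-lastOf (+ 0) w (+≤+ z≤n ∷ w≤n)) (+≤+ (ℕ.n≤1+n n))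

  desB≡sum-descents : desB w ≡ sum (descents n w)
  desB≡sum-descents = begin
    length (descPos 0 (+ 0 ∷ w))       ≡⟨ length-descPos 0 (+ 0) w ⟩
    sum (steps descent (+ 0) w)        ≡⟨ sum-∷ʳ-0 (steps descent (+ 0) w) ⟨
    sum (steps descent (+ 0) w ∷ʳ 0)   ≡⟨ cong sum descents-∷ʳ ⟨
    sum (descents n w)                 ∎

  fmaj≡weight-descents : fmaj w ≡ 2 * weight (descents n w) + sum (map negative w)
  fmaj≡weight-descents = cong₂ _+_ majorIndex (length-filterᵇ (_<ᵇ + 0) w)
    where
    majorIndex : sum (map (λ i → 2 * i) (DesB w)) ≡ 2 * weight (descents n w)
    majorIndex = begin
      sum (map (λ i → 2 * i) (DesB w))        ≡⟨ sum-map-*ˡ 2 (DesB w) ⟩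
      2 * sum (descPos 0 (+ 0 ∷ w))           ≡⟨ cong (2 *_) (sum-descPos 0 (+ 0) w) ⟩
      2 * weight (steps descent (+ 0) w)      ≡⟨ cong (2 *_) (weight-∷ʳ-0 (steps descent (+ 0) w)) ⟨
      2 * weight (steps descent (+ 0) w ∷ʳ 0) ≡⟨ cong (λ ds → 2 * weight ds) descents-∷ʳ ⟨
      2 * weight (descents n w)               ∎

-- The half turn

i+j-j≡i : ∀ i j → i ℤ.+ j - j ≡ i
i+j-j≡i = ℤ-Solver.solve-∀

i-j+j≡i : ∀ i j → i - j ℤ.+ j ≡ i
i-j+j≡i = ℤ-Solver.solve-∀

-i+[1+i]≡1 : ∀ i → - i ℤ.+ (+ 1 ℤ.+ i) ≡ + 1
-i+[1+i]≡1 = ℤ-Solver.solve-∀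

<ᵇ-+-cancelʳ : ∀ x y c → (x ℤ.+ c <ᵇ y ℤ.+ c) ≡ (x <ᵇ y)
<ᵇ-+-cancelʳ x y c with x ℤ.<? y
... | yes x<y = <ᵇ-true (ℤ.+-monoˡ-< c x<y)
... | no  x≮y = <ᵇ-false λ x+c<y+c →
  x≮y (subst₂ ℤ._<_ (i+j-j≡i x c) (i+j-j≡i y c) (ℤ.+-monoˡ-< (- c) x+c<y+c))

indicator-trichotomy : ∀ {x y} → x ≢ y → indicator (x <ᵇ y) + indicator (y <ᵇ x) ≡ 1
indicator-trichotomy {x} {y} x≢y with ℤ.<-cmp x y
... | tri< x<y _ y≮x rewrite <ᵇ-true x<y | <ᵇ-false y≮x = refl
... | tri≈ _ x≡y _ = contradiction x≡y x≢y
... | tri> x≮y _ y<x rewrite <ᵇ-false x≮y | <ᵇ-true y<x = refl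

-- For a letter x of a signed permutation of [n] this is x ↦ -sgn(x) (n + 1 - |x|).
halfTurn : ℕ → ℤ → ℤ
halfTurn n x = if + 0 <ᵇ x then x - + suc n else x ℤ.+ + suc n

-- The alphabet of the extended words 0 π₁ ⋯ πₙ (n+1).
InRange : ℕ → ℤ → Set
InRange n x = - + n ℤ.≤ x × x ℤ.≤ + suc n

halfTurn-pos : ∀ n {x} → + 0 ℤ.< x → halfTurn n x ≡ x - + suc n
halfTurn-pos n 0<x rewrite <ᵇ-true 0<x = refl

halfTurn-nonpos : ∀ n {x} → ¬ + 0 ℤ.< x → halfTurn n x ≡ x ℤ.+ + suc n
halfTurn-nonpos n 0≮x rewrite <ᵇ-false 0≮x = refl

positive-pos : ∀ {x} → + 0 ℤ.< x → positive x ≡ 1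
positive-pos 0<x rewrite <ᵇ-true 0<x = refl

positive-nonpos : ∀ {x} → ¬ + 0 ℤ.< x → positive x ≡ 0
positive-nonpos 0≮x rewrite <ᵇ-false 0≮x = refl

0<x+[1+n] : ∀ n {x} → - + n ℤ.≤ x → + 0 ℤ.< x ℤ.+ + suc n
0<x+[1+n] n {x} -n≤x = ℤ.<-≤-trans (+<+ (s≤s z≤n))
  (subst (ℤ._≤ x ℤ.+ + suc n) (-i+[1+i]≡1 (+ n)) (ℤ.+-monoˡ-≤ (+ suc n) -n≤x))

halfTurn-involutive : ∀ n {x} → InRange n x → halfTurn n (halfTurn n x) ≡ x
halfTurn-involutive n {x} (-n≤x , x≤N) with toSum (+ 0 ℤ.<? x)
... | inj₁ 0<x = begin
  halfTurn n (halfTurn n x)        ≡⟨ cong (halfTurn n) (halfTurn-pos n 0<x) ⟩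
  halfTurn n (x - + suc n)         ≡⟨ halfTurn-nonpos n (ℤ.≤⇒≯ (ℤ.i≤j⇒i-j≤0 x≤N)) ⟩
  x - + suc n ℤ.+ + suc n          ≡⟨ i-j+j≡i x (+ suc n) ⟩
  x                                ∎
... | inj₂ 0≮x = begin
  halfTurn n (halfTurn n x)        ≡⟨ cong (halfTurn n) (halfTurn-nonpos n 0≮x) ⟩
  halfTurn n (x ℤ.+ + suc n)       ≡⟨ halfTurn-pos n (0<x+[1+n] n -n≤x) ⟩
  x ℤ.+ + suc n - + suc n          ≡⟨ i+j-j≡i x (+ suc n) ⟩
  x                                ∎

halfTurn-law : ∀ n {a b} → InRange n a → InRange n b → a ≢ b →
  indicator (halfTurn n a <ᵇ halfTurn n b) + indicator (b <ᵇ a) + positive b ≡ 1 + positive a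
halfTurn-law n {a} {b} (-n≤a , a≤N) (-n≤b , b≤N) a≢b with toSum (+ 0 ℤ.<? a) | toSum (+ 0 ℤ.<? b)
... | inj₁ 0<a | inj₁ 0<b
  rewrite halfTurn-pos n 0<a | halfTurn-pos n 0<b | positive-pos 0<a | positive-pos 0<b
        | <ᵇ-+-cancelʳ a b (- + suc n) = cong (_+ 1) (indicator-trichotomy a≢b)
... | inj₂ 0≮a | inj₂ 0≮b
  rewrite halfTurn-nonpos n 0≮a | halfTurn-nonpos n 0≮b | positive-nonpos 0≮a | positive-nonpos 0≮b
        | <ᵇ-+-cancelʳ a b (+ suc n) = cong (_+ 0) (indicator-trichotomy a≢b)
... | inj₁ 0<a | inj₂ 0≮b
  rewrite halfTurn-pos n 0<a | halfTurn-nonpos n 0≮b | positive-pos 0<a | positive-nonpos 0≮b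
        | <ᵇ-true (ℤ.≤-<-trans (ℤ.i≤j⇒i-j≤0 a≤N) (0<x+[1+n] n -n≤b))
        | <ᵇ-true (ℤ.≤-<-trans (ℤ.≮⇒≥ 0≮b) 0<a) = refl
... | inj₂ 0≮a | inj₁ 0<b
  rewrite halfTurn-nonpos n 0≮a | halfTurn-pos n 0<b | positive-nonpos 0≮a | positive-pos 0<b
        | <ᵇ-false (ℤ.<-asym (ℤ.≤-<-trans (ℤ.i≤j⇒i-j≤0 b≤N) (0<x+[1+n] n -n≤a)))
        | <ᵇ-false (ℤ.<-asym (ℤ.≤-<-trans (ℤ.≮⇒≥ 0≮a) 0<b)) = refl

record Letter (n : ℕ) (x : ℤ) : Set where
  constructor letter
  field
    nonzero : 0 < ∣ x ∣
    bounded : ∣ x ∣ ≤ n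

∈-signedPerms⇒Letter : ∀ n {w x} → w ∈ signedPerms n → x ∈ w → Letter n x
∈-signedPerms⇒Letter n w∈ x∈w
  with 0<∣x∣ , ∣x∣≤n ← ∈-[ n ]⁻ (↭.∈-resp-↭ (∈-signedPerms⁻ n w∈) (∈-map⁺ ∣_∣ x∈w))
  = letter 0<∣x∣ ∣x∣≤n

Letter⇒InRange : ∀ {n x} → Letter n x → InRange n x
Letter⇒InRange {n}     {+ suc k}   (letter _ k<n)       = ℤ.neg-≤-pos , +≤+ (ℕ.m≤n⇒m≤1+n k<n)
Letter⇒InRange {suc n} { -[1+ k ]} (letter _ (s≤s k≤n)) = ℤ.-≤- k≤n , ℤ.-≤+

Letter⇒≤ : ∀ {n x} → Letter n x → x ℤ.≤ + n
Letter⇒≤ {x = + suc k}   (letter _ k<n) = +≤+ k<n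
Letter⇒≤ {x = -[1+ k ]} _              = ℤ.-≤+

Letter⇒≢0 : ∀ {n x} → Letter n x → x ≢ + 0
Letter⇒≢0 (letter () _) refl

∣halfTurn∣ : ∀ n {x} → Letter n x → ∣ halfTurn n x ∣ ≡ suc n ∸ ∣ x ∣
∣halfTurn∣ n {+ suc k}   (letter _ k<n) =
  trans (cong ∣_∣ (ℤ.[+m]-[+n]≡m⊖n (suc k) (suc n))) (ℤ.∣⊖∣-≤ (ℕ.m≤n⇒m≤1+n k<n))
∣halfTurn∣ n { -[1+ k ]} (letter _ k<n) = cong ∣_∣ (ℤ.⊖-≥ (ℕ.m≤n⇒m≤1+n k<n))

halfTurn-[1+n] : ∀ n → halfTurn n (+ suc n) ≡ + 0
halfTurn-[1+n] n = ℤ.+-inverseʳ (+ suc n)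

negative-halfTurn : ∀ n {x} → Letter n x → negative (halfTurn n x) ≡ positive x
negative-halfTurn n {x} x-letter with toSum (+ 0 ℤ.<? x)
... | inj₁ 0<x rewrite halfTurn-pos n 0<x | positive-pos 0<x =
  cong indicator (<ᵇ-true {x - + suc n} x-N<0)
  where
  x-N<0 : x - + suc n ℤ.< + 0
  x-N<0 = subst (x - + suc n ℤ.<_) (ℤ.+-inverseʳ (+ suc n))
            (ℤ.+-monoˡ-< (- + suc n) (ℤ.≤-<-trans (Letter⇒≤ x-letter) (+<+ ℕ.≤-refl)))
... | inj₂ 0≮x rewrite halfTurn-nonpos n 0≮x | positive-nonpos 0≮x =
  cong indicator (<ᵇ-false {x ℤ.+ + suc n} (ℤ.<-asym (0<x+[1+n] n (proj₁ (Letter⇒InRange x-letter)))))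

-- The involution

complement-[_] : ∀ n → map (suc n ∸_) [ n ] ↭ [ n ]
complement-[ n ] = map-involution-↭ (suc n ∸_) Unique-[ n ] closed involutive
  where
  closed : ∀ {k} → k ∈ [ n ] → suc n ∸ k ∈ [ n ]
  closed {zero}  k∈ with () , _ ← ∈-[ n ]⁻ k∈
  closed {suc j} k∈ with _ , j<n ← ∈-[ n ]⁻ k∈ =
    ∈-[ n ]⁺ (ℕ.m<n⇒0<n∸m j<n) (ℕ.m∸n≤m n j)
  involutive : ∀ {k} → k ∈ [ n ] → suc n ∸ (suc n ∸ k) ≡ k
  involutive k∈ = ℕ.m∸[m∸n]≡n (ℕ.m≤n⇒m≤1+n (proj₂ (∈-[ n ]⁻ k∈)))

turnAround : ℕ → List ℤ → List ℤ
turnAround n w = reverse (map (halfTurn n) w)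

module _ (n : ℕ) {w : List ℤ} (w∈ : w ∈ signedPerms n) where

  letters : All (Letter n) w
  letters = All.tabulate (∈-signedPerms⇒Letter n w∈)

  turnAround-∈ : turnAround n w ∈ signedPerms n
  turnAround-∈ = ∈-signedPerms⁺ n (subst (_↭ [ n ]) (sym ∣turnAround∣)
    (↭-trans (↭.↭-reverse _)
    (↭-trans (↭.map⁺ (suc n ∸_) (∈-signedPerms⁻ n w∈))
             complement-[ n ])))
    where
    ∣turnAround∣ : map ∣_∣ (turnAround n w) ≡ reverse (map (suc n ∸_) (map ∣_∣ w))
    ∣turnAround∣ = begin
      map ∣_∣ (reverse (map (halfTurn n) w))
        ≡⟨ reverse-map ∣_∣ (map (halfTurn n) w) ⟩
      reverse (map ∣_∣ (map (halfTurn n) w))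
        ≡⟨ cong reverse (map-∘ w) ⟨
      reverse (map (∣_∣ ∘ halfTurn n) w)
        ≡⟨ cong reverse (map-cong-local (All.map (∣halfTurn∣ n) letters)) ⟩
      reverse (map ((suc n ∸_) ∘ ∣_∣) w)
        ≡⟨ cong reverse (map-∘ w) ⟩
      reverse (map (suc n ∸_) (map ∣_∣ w)) ∎

  turnAround-involutive : turnAround n (turnAround n w) ≡ w
  turnAround-involutive = begin
    reverse (map (halfTurn n) (reverse (map (halfTurn n) w)))
      ≡⟨ cong reverse (reverse-map (halfTurn n) (map (halfTurn n) w)) ⟩
    reverse (reverse (map (halfTurn n) (map (halfTurn n) w)))
      ≡⟨ reverse-involutive (map (halfTurn n) (map (halfTurn n) w)) ⟩
    map (halfTurn n) (map (halfTurn n) w)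
      ≡⟨ map-∘ w ⟨
    map (halfTurn n ∘ halfTurn n) w
      ≡⟨ map-cong-local (All.map (halfTurn-involutive n ∘ Letter⇒InRange) letters) ⟩
    map (λ x → x) w
      ≡⟨ map-id w ⟩
    w ∎

turnedAscent : ℕ → ℤ → ℤ → ℕ
turnedAscent n a b = indicator (halfTurn n a <ᵇ halfTurn n b)

-- Adding the same K to both sides lets the linear combination of the hypotheses avoid subtraction.
fmaj-arithmetic : ∀ n a d wa wd wr p q →
  a + d ≡ n →
  2 * (wa + wd) + 2 * suc n * 1 + suc n ≡ suc n * suc n + 2 * (p + 1) →
  wr + wa + a ≡ suc n * a →
  q + p ≡ n →
  2 * wr + p + 2 * n * d ≡ 2 * wd + q + n * n
fmaj-arithmetic n a d wa wd wr p q a+d≡n weights reversal q+p≡n = ℕ.+-cancelʳ-≡ K _ _ (begin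
  2 * wr + p + 2 * n * d + K
    ≡⟨ step₁ n a d wa wr p ⟩
  2 * (wr + wa + a) + 2 * n * d + 2 * p + 3 * suc n
    ≡⟨ cong (λ t → 2 * t + 2 * n * d + 2 * p + 3 * suc n) reversal ⟩
  2 * (suc n * a) + 2 * n * d + 2 * p + 3 * suc n
    ≡⟨ step₂ n a d p ⟩
  2 * n * (a + d) + 2 * a + 2 * p + 3 * suc n
    ≡⟨ cong (λ t → 2 * n * t + 2 * a + 2 * p + 3 * suc n) a+d≡n ⟩
  2 * n * n + 2 * a + 2 * p + 3 * suc n
    ≡⟨ step₃ n a p ⟩
  suc n * suc n + 2 * (p + 1) + n + n * n + 2 * a
    ≡⟨ cong (λ t → suc n * suc n + 2 * (p + 1) + t + n * n + 2 * a) q+p≡n ⟨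
  suc n * suc n + 2 * (p + 1) + (q + p) + n * n + 2 * a
    ≡⟨ cong (λ t → t + (q + p) + n * n + 2 * a) weights ⟨
  2 * (wa + wd) + 2 * suc n * 1 + suc n + (q + p) + n * n + 2 * a
    ≡⟨ step₄ n a wa wd p q ⟩
  2 * wd + q + n * n + K ∎)
  where
  K = 2 * wa + 2 * a + 3 * suc n + p
  step₁ : ∀ n a d wa wr p → 2 * wr + p + 2 * n * d + (2 * wa + 2 * a + 3 * suc n + p)
                            ≡ 2 * (wr + wa + a) + 2 * n * d + 2 * p + 3 * suc n
  step₁ = solve-∀
  step₂ : ∀ n a d p → 2 * (suc n * a) + 2 * n * d + 2 * p + 3 * suc n
                      ≡ 2 * n * (a + d) + 2 * a + 2 * p + 3 * suc n
  step₂ = solve-∀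
  step₃ : ∀ n a p → 2 * n * n + 2 * a + 2 * p + 3 * suc n
                    ≡ suc n * suc n + 2 * (p + 1) + n + n * n + 2 * a
  step₃ = solve-∀
  step₄ : ∀ n a wa wd p q → 2 * (wa + wd) + 2 * suc n * 1 + suc n + (q + p) + n * n + 2 * a
                            ≡ 2 * wd + q + n * n + (2 * wa + 2 * a + 3 * suc n + p)
  step₄ = solve-∀

module _ (n : ℕ) {w : List ℤ} (w∈ : w ∈ signedPerms n) where

  private
    N : ℤ
    N = + suc n
    h : ℤ → ℤ
    h = halfTurn n
    ascents : List ℕ
    ascents = steps (turnedAscent n) (+ 0) (w ∷ʳ N)
    positives : ℕ
    positives = sum (map positive w)
    w≤n : All (ℤ._≤ + n) w
    w≤n = All.map Letter⇒≤ (letters n w∈)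
    turnAround≤n : All (ℤ._≤ + n) (turnAround n w)
    turnAround≤n = All.map Letter⇒≤ (letters n (turnAround-∈ n w∈))

  descents-turnAround : descents n (turnAround n w) ≡ reverse ascents
  descents-turnAround = begin
    steps descent (+ 0) (reverse (map h w) ∷ʳ N)
      ≡⟨ cong (λ z → steps descent z (reverse (map h w) ∷ʳ N)) (halfTurn-[1+n] n) ⟨
    steps descent (h N) (reverse (map h w) ∷ʳ h (+ 0))
      ≡⟨ steps-reverse descent (h (+ 0)) (map h w) (h N) ⟩
    reverse (steps (flip descent) (h (+ 0)) (map h w ∷ʳ h N))
      ≡⟨ cong (λ z → reverse (steps (flip descent) (h (+ 0)) z)) (map-++ h w (N ∷ [])) ⟨
    reverse (steps (flip descent) (h (+ 0)) (map h (w ∷ʳ N)))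
      ≡⟨ cong reverse (steps-map (flip descent) h (+ 0) (w ∷ʳ N)) ⟩
    reverse ascents ∎

  telescopes : Linked (Telescoping (turnedAscent n) descent positive) (+ 0 ∷ w ∷ʳ N)
  telescopes = Linked-fromAll (halfTurn-law n) inRange (AllPairs⇒Linked distinct)
    where
    inRange : All (InRange n) (+ 0 ∷ w ∷ʳ N)
    inRange = (ℤ.neg-≤-pos , +≤+ z≤n)
            ∷ All.∷ʳ⁺ (All.map Letter⇒InRange (letters n w∈)) (ℤ.neg-≤-pos , ℤ.≤-refl)
    unique-w : Unique w
    unique-w = Unique.map⁻ (Unique-resp-↭ (↭-sym (∈-signedPerms⁻ n w∈)) Unique-[ n ])
    N∉w : ∀ {x} → ¬ (x ∈ w × x ∈ N ∷ [])
    N∉w (x∈w , here refl) = ℕ.1+n≰n (Letter.bounded (All.lookup (letters n w∈) x∈w))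
    distinct : Unique (+ 0 ∷ w ∷ʳ N)
    distinct = All.∷ʳ⁺ (All.map (λ l → Letter⇒≢0 l ∘ sym) (letters n w∈)) (λ ())
             ∷ Unique.++⁺ unique-w ([] ∷ []) N∉w

  length-w : length w ≡ n
  length-w = begin
    length w                   ≡⟨ length-map ∣_∣ w ⟨
    length (map ∣_∣ w)         ≡⟨ ↭.↭-length (∈-signedPerms⁻ n w∈) ⟩
    length (map suc (upTo n))  ≡⟨ length-map suc (upTo n) ⟩
    length (upTo n)            ≡⟨ length-upTo n ⟩
    n                          ∎

  length-extended : length (w ∷ʳ N) ≡ suc n
  length-extended = trans (length-++ w) (trans (ℕ.+-comm (length w) 1) (cong suc length-w))

  sum-ascents+descents : sum ascents + sum (descents n w) ≡ n
  sum-ascents+descents = ℕ.suc-injective (begin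
    suc (a + d)
      ≡⟨ ℕ.+-comm 1 (a + d) ⟩
    a + d + positive N
      ≡⟨ cong (λ x → a + d + positive x) (lastOf-∷ʳ (+ 0) w N) ⟨
    a + d + positive (lastOf (+ 0) (w ∷ʳ N))
      ≡⟨ sum-steps-telescope (turnedAscent n) descent positive (+ 0) (w ∷ʳ N) telescopes ⟩
    length (w ∷ʳ N) + 0
      ≡⟨ cong (_+ 0) length-extended ⟩
    suc n + 0
      ≡⟨ ℕ.+-identityʳ (suc n) ⟩
    suc n ∎)
    where
    a d : ℕ
    a = sum ascents
    d = sum (descents n w)

  weight-ascents+descents : 2 * (weight ascents + weight (descents n w)) + 2 * suc n * 1 + suc n
                            ≡ suc n * suc n + 2 * (positives + 1)
  weight-ascents+descents = begin
    2 * W + 2 * suc n * 1 + suc n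
      ≡⟨ cong₂ (λ l x → 2 * W + 2 * l * positive x + l) length-extended (lastOf-∷ʳ (+ 0) w N) ⟨
    2 * W + 2 * length (w ∷ʳ N) * positive (lastOf (+ 0) (w ∷ʳ N)) + length (w ∷ʳ N)
      ≡⟨ weight-steps-telescope (turnedAscent n) descent positive (+ 0) (w ∷ʳ N) telescopes ⟩
    length (w ∷ʳ N) * length (w ∷ʳ N) + 2 * sum (map positive (w ∷ʳ N))
      ≡⟨ cong₂ (λ l s → l * l + 2 * s) length-extended positives-extended ⟩
    suc n * suc n + 2 * (positives + 1) ∎
    where
    W : ℕ
    W = weight ascents + weight (descents n w)
    positives-extended : sum (map positive (w ∷ʳ N)) ≡ positives + 1
    positives-extended = trans (cong sum (map-++ positive w (N ∷ []))) (sum-++ (map positive w) (1 ∷ []))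

  reversal : weight (reverse ascents) + weight ascents + sum ascents ≡ suc n * sum ascents
  reversal = trans (weight-reverse ascents)
    (cong (_* sum ascents) (trans (length-steps (turnedAscent n) (+ 0) (w ∷ʳ N)) length-extended))

  negatives-turnAround : sum (map negative (turnAround n w)) ≡ positives
  negatives-turnAround = begin
    sum (map negative (reverse (map h w)))
      ≡⟨ cong sum (reverse-map negative (map h w)) ⟩
    sum (reverse (map negative (map h w)))
      ≡⟨ sum-↭ (↭.↭-reverse (map negative (map h w))) ⟩
    sum (map negative (map h w))
      ≡⟨ cong sum (map-∘ w) ⟨
    sum (map (negative ∘ h) w)
      ≡⟨ cong sum (map-cong-local (All.map (negative-halfTurn n) (letters n w∈))) ⟩
    positives ∎

  negatives+positives : sum (map negative w) + positives ≡ n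
  negatives+positives = trans (sum-complementary negative positive complementary) length-w
    where
    complementary : All (λ x → negative x + positive x ≡ 1) w
    complementary = All.map (λ l → indicator-trichotomy (Letter⇒≢0 l)) (letters n w∈)

  desB-turnAround : desB (turnAround n w) + desB w ≡ n
  desB-turnAround = begin
    desB (turnAround n w) + desB w
      ≡⟨ cong₂ _+_ (desB≡sum-descents turnAround≤n) (desB≡sum-descents w≤n) ⟩
    sum (descents n (turnAround n w)) + sum (descents n w)
      ≡⟨ cong (λ ds → sum ds + sum (descents n w)) descents-turnAround ⟩
    sum (reverse ascents) + sum (descents n w)
      ≡⟨ cong (λ s → s + sum (descents n w)) (sum-↭ (↭.↭-reverse ascents)) ⟩
    sum ascents + sum (descents n w)
      ≡⟨ sum-ascents+descents ⟩
    n ∎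

  fmaj-turnAround : fmaj (turnAround n w) + 2 * n * desB w ≡ fmaj w + n * n
  fmaj-turnAround = begin
    fmaj (turnAround n w) + 2 * n * desB w
      ≡⟨ cong₂ (λ f d → f + 2 * n * d)
               (fmaj≡weight-descents turnAround≤n) (desB≡sum-descents w≤n) ⟩
    2 * weight (descents n (turnAround n w)) + sum (map negative (turnAround n w)) + 2 * n * sum (descents n w)
      ≡⟨ cong₂ (λ ds m → 2 * weight ds + m + 2 * n * sum (descents n w))
               descents-turnAround negatives-turnAround ⟩
    2 * weight (reverse ascents) + positives + 2 * n * sum (descents n w)
      ≡⟨ fmaj-arithmetic n (sum ascents) (sum (descents n w)) (weight ascents) (weight (descents n w))
           (weight (reverse ascents)) positives (sum (map negative w))
           sum-ascents+descents weight-ascents+descents reversal negatives+positives ⟩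
    2 * weight (descents n w) + sum (map negative w) + n * n
      ≡⟨ cong (_+ n * n) (fmaj≡weight-descents w≤n) ⟨
    fmaj w + n * n ∎

-- Counting

T-injective : {a b : Bool} → (T a → T b) → (T b → T a) → a ≡ b
T-injective {false} {false} _ _ = refl
T-injective {false} {true}  _ g = ⊥-elim (g _)
T-injective {true}  {false} f _ = ⊥-elim (f _)
T-injective {true}  {true}  _ _ = refl

∧-cong : {a b c d : Bool} → a ≡ b → (T a → c ≡ d) → (a ∧ c) ≡ (b ∧ d)
∧-cong {false} refl _ = refl
∧-cong {true}  refl f = f _

≡ᵇ-complement : ∀ {t s n k} → t + s ≡ n → k ≤ n → (t ≡ᵇ k) ≡ (s ≡ᵇ n ∸ k)
≡ᵇ-complement {t} {s} {n} {k} t+s≡n k≤n = T-injective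
  (λ t≡ᵇk → ℕ.≡⇒≡ᵇ s (n ∸ k) (s≡n∸k (ℕ.≡ᵇ⇒≡ t k t≡ᵇk)))
  (λ s≡ᵇn∸k → ℕ.≡⇒≡ᵇ t k (t≡k (ℕ.≡ᵇ⇒≡ s (n ∸ k) s≡ᵇn∸k)))
  where
  s≡n∸k : t ≡ k → s ≡ n ∸ k
  s≡n∸k refl = trans (sym (ℕ.m+n∸m≡n t s)) (cong (_∸ t) t+s≡n)
  t≡k : s ≡ n ∸ k → t ≡ k
  t≡k refl = trans (sym (ℕ.m+n∸n≡m t s)) (trans (cong (_∸ s) t+s≡n) (ℕ.m∸[m∸n]≡n k≤n))

⌊≟⌋-+-cancelʳ : ∀ x y c → ⌊ x ℤ.+ c ℤ.≟ y ℤ.+ c ⌋ ≡ ⌊ x ℤ.≟ y ⌋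
⌊≟⌋-+-cancelʳ x y c with x ℤ.≟ y
... | yes x≡y = ⌊⌋-yes (x ℤ.+ c ℤ.≟ y ℤ.+ c) (cong (ℤ._+ c) x≡y)
... | no  x≢y = ⌊⌋-no (x ℤ.+ c ℤ.≟ y ℤ.+ c) λ x+c≡y+c →
  x≢y (trans (sym (i+j-j≡i x c)) (trans (cong (_- c) x+c≡y+c) (i+j-j≡i y c)))

i+j-k≡i-[k-j] : ∀ i j k → i ℤ.+ j - k ≡ i - (k - j)
i+j-k≡i-[k-j] = ℤ-Solver.solve-∀

⌊≟⌋-shift : ∀ {a b x y : ℕ} (m : ℤ) → b + x ≡ a + y →
            ⌊ + a ℤ.≟ m ⌋ ≡ ⌊ + b ℤ.≟ m - (+ x - + y) ⌋
⌊≟⌋-shift {a} {b} {x} {y} m b+x≡a+y = begin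
  ⌊ + a ℤ.≟ m ⌋
    ≡⟨ ⌊≟⌋-+-cancelʳ (+ a) m (- (+ x - + y)) ⟨
  ⌊ + a - (+ x - + y) ℤ.≟ m - (+ x - + y) ⌋
    ≡⟨ cong (λ z → ⌊ z ℤ.≟ m - (+ x - + y) ⌋) shifted ⟨
  ⌊ + b ℤ.≟ m - (+ x - + y) ⌋ ∎
  where
  shifted : + b ≡ + a - (+ x - + y)
  shifted = begin
    + b                  ≡⟨ i+j-j≡i (+ b) (+ x) ⟨
    + (b + x) - + x      ≡⟨ cong (λ z → + z - + x) b+x≡a+y ⟩
    + (a + y) - + x      ≡⟨ i+j-k≡i-[k-j] (+ a) (+ y) (+ x) ⟩
    + a - (+ x - + y)    ∎

counted : ℕ → ℤ → List ℤ → Bool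
counted k m π = (desB π ≡ᵇ k) ∧ ⌊ (+ fmaj π) ℤ.≟ m ⌋

counted-turnAround : ∀ n {k} → k ≤ n → (m : ℤ) → ∀ {π} → π ∈ signedPerms n →
  counted k m (turnAround n π) ≡ counted (n ∸ k) (m - ((+ (2 * n * k)) - (+ (n * n)))) π
counted-turnAround n {k} k≤n m {π} π∈ =
  ∧-cong (≡ᵇ-complement {desB τ} {desB π} (desB-turnAround n π∈) k≤n) fmaj-match
  where
  τ : List ℤ
  τ = turnAround n π
  fmaj-match : T (desB τ ≡ᵇ k) →
               ⌊ + fmaj τ ℤ.≟ m ⌋ ≡ ⌊ + fmaj π ℤ.≟ m - (+ (2 * n * k) - + (n * n)) ⌋
  fmaj-match t≡ᵇk with refl ← ℕ.≡ᵇ⇒≡ (desB τ) k t≡ᵇk = ⌊≟⌋-shift m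
    (subst (λ σ → fmaj σ + 2 * n * desB τ ≡ fmaj τ + n * n) (turnAround-involutive n π∈)
      (fmaj-turnAround n (turnAround-∈ n π∈)))

proposition2p3 : (n k : ℕ) → k ≤ n → (m : ℤ) →
    Bcoeff n k m ≡ Bcoeff n (n ∸ k) (m - ((+ (2 * n * k)) - (+ (n * n))))
proposition2p3 n k k≤n m =
  length-filterᵇ-involution (counted k m) (counted (n ∸ k) (m - ((+ (2 * n * k)) - (+ (n * n)))))
    (turnAround n) (Unique-signedPerms n) (turnAround-∈ n) (turnAround-involutive n)
    (counted-turnAround n k≤n m)
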